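{- Fix an integer $b$ with $1\le b\le 9$, $b\ne7$, and let $S_b=\{(x,y,z)\in\mathbb{Z}_{>0}^3:(x+y+z)^2=bxyz\}$. Let $s_0=(x,y_0,z_0)\in S_b$ satisfy $x\le y_0\le z_0\le x+y_0$, and define recursively $y_{j+1}=z_j$, $z_{j+1}=bxy_{j+1}-2(x+y_{j+1})-y_j$ for $j\ge0$. For each triple $(x,y,z)=(x,y_j,z_j)$, $j\ge 0$, let $$T_{xyz}=\{a\in\mathbb{R}^2 : \langle u_i,a\rangle\le 1,\ i=1,2,3\},\quad u_1=\begin{pmatrix} y\\ (y+z)/x\end{pmatrix},\ u_2=\begin{pmatrix}-x\\-1\end{pmatrix},\ u_3=\begin{pmatrix}0\\-1\end{pmatrix}.$$ Then $T_{xyz}$ is pseudointegral, has exactly one lattice point in its interior, and has exactly $b$ lattice points on its boundary.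
   Context: A polygon $T$ is pseudointegral if $t\mapsto|tT\cap\mathbb{Z}^2|$ ($t\in\mathbb{Z}_{>0}$) is a polynomial function of $t$. -}

module Defs where

open import Data.Nat as ℕ using (ℕ; zero; suc; NonZero)
open import Data.Integer as ℤ using (ℤ; +_)
open import Data.Rational as ℚ using (ℚ; _/_)
open import Data.Product using (Σ; _×_; _,_)
open import Data.Sum using (_⊎_)
open import Data.List using (List; []; _∷_; length)
open import Data.List.Relation.Unary.All using (All)
open import Data.List.Relation.Unary.Unique.Propositional using (Unique)
open import Data.List.Membership.Propositional using (_∈_)
open import Relation.Binary.PropositionalEquality using (_≡_)

Pt : Set
Pt = ℤ × ℤ

-- Vectors of ℚ² (all data of T_{xyz} is rational)
V2 : Set
V2 = ℚ × ℚ

ℤ→ℚ : ℤ → ℚ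
ℤ→ℚ n = n / 1

emb : Pt → V2
emb (p , q) = ℤ→ℚ p , ℤ→ℚ q

⟪_,_⟫ : V2 → V2 → ℚ
⟪ (a , b) , (c , d) ⟫ = a ℚ.* c ℚ.+ b ℚ.* d

u₁ : (x : ℕ) .{{_ : NonZero x}} → ℤ → ℤ → V2
u₁ x y z = ℤ→ℚ y , (y ℤ.+ z) / x

u₂ : ℕ → V2
u₂ x = ℚ.- ℤ→ℚ (+ x) , ℚ.- ℚ.1ℚ

u₃ : V2
u₃ = ℚ.0ℚ , ℚ.- ℚ.1ℚ

InDilate : (x : ℕ) .{{_ : NonZero x}} → ℤ → ℤ → ℕ → V2 → Set
InDilate x y z t a =
  (⟪ u₁ x y z , a ⟫ ℚ.≤ T) × (⟪ u₂ x , a ⟫ ℚ.≤ T) × (⟪ u₃ , a ⟫ ℚ.≤ T)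
  where T = ℤ→ℚ (+ t)

InInterior : (x : ℕ) .{{_ : NonZero x}} → ℤ → ℤ → V2 → Set
InInterior x y z a =
  (⟪ u₁ x y z , a ⟫ ℚ.< ℚ.1ℚ) × (⟪ u₂ x , a ⟫ ℚ.< ℚ.1ℚ) × (⟪ u₃ , a ⟫ ℚ.< ℚ.1ℚ)

OnBoundary : (x : ℕ) .{{_ : NonZero x}} → ℤ → ℤ → V2 → Set
OnBoundary x y z a =
  InDilate x y z 1 a ×
  ((⟪ u₁ x y z , a ⟫ ≡ ℚ.1ℚ) ⊎ (⟪ u₂ x , a ⟫ ≡ ℚ.1ℚ) ⊎ (⟪ u₃ , a ⟫ ≡ ℚ.1ℚ))

HasCard : (Pt → Set) → ℕ → Set
HasCard P n =
  Σ (List Pt) λ l → (length l ≡ n) × Unique l × All P l × (∀ a → P a → a ∈ l)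

evalPoly : List ℚ → ℚ → ℚ
evalPoly []       t = ℚ.0ℚ
evalPoly (c ∷ cs) t = c ℚ.+ t ℚ.* evalPoly cs t

Pseudointegral : (x : ℕ) .{{_ : NonZero x}} → ℤ → ℤ → Set
Pseudointegral x y z =
  Σ (List ℚ) λ cs → (t : ℕ) → 1 ℕ.≤ t →
    Σ ℕ λ n → HasCard (λ a → InDilate x y z t (emb a)) n ×
              (ℤ→ℚ (+ n) ≡ evalPoly cs (ℤ→ℚ (+ t)))

seqYZ : ℕ → ℕ → ℕ → ℕ → ℕ → ℤ × ℤ
seqYZ b x y₀ z₀ zero = + y₀ , + z₀
seqYZ b x y₀ z₀ (suc j) with seqYZ b x y₀ z₀ j
... | (y , z) = z , (+ b ℤ.* + x ℤ.* z ℤ.- + 2 ℤ.* (+ x ℤ.+ z) ℤ.- y)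

seqY seqZ : ℕ → ℕ → ℕ → ℕ → ℕ → ℤ
seqY b x y₀ z₀ j with seqYZ b x y₀ z₀ j
... | (y , _) = y
seqZ b x y₀ z₀ j with seqYZ b x y₀ z₀ j
... | (_ , z) = z

{-# OPTIONS --safe #-}
module Submission where

-- Put M = (x + y + z)/x and r = bz/x. When these are integers, u₁ = (y, M − 1) and tT is cut
-- out by three integral linear forms vᵢ · a ≤ t. The lattice points of (t+1)T not in tT are its
-- boundary points, and they are in bijection with {1, …, b(t+1)}: a parameter c runs along the
-- edge v₂ · a = t+1 while zc ≤ (t+1)M, along the edge v₃ · a = t+1 while y(b(t+1) − c) ≤ (t+1)M,
-- and along the third edge in between; the first two ranges are disjoint because
-- byz − M(y + z) = xM > 0 by the equation. Hence |tT ∩ ℤ²| = 1 + b·t(t+1)/2; the interior points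
-- of T are those of 0T = {0}, and its boundary carries b of them.
-- Integrality (x ∣ y + z, x ∣ by, x ∣ bz) holds at the root triple, which x ≤ y ≤ z ≤ x + y
-- confines to 5 ≤ bx ≤ 10 and y < 9x where it is checked by computation, and it is preserved by
-- the Vieta jump y ↦ bxz − 2(x + z) − y to the other root of the equation in y.

open import Defs

open import Data.Nat as ℕ using (ℕ; zero; suc; NonZero)
import Data.Nat.Properties as ℕP
import Data.Nat.Tactic.RingSolver as ℕ-Ring
import Data.Nat.Divisibility as ℕᵈ
open import Data.Nat.Coprimality using (1-coprimeTo) renaming (sym to coprime-sym)
import Data.Integer as ℤ
open ℤ using (ℤ; +_)
import Data.Integer.Properties as ℤP
open import Data.Rational as ℚ using (ℚ; mkℚ; _/_; 0ℚ; 1ℚ)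
import Data.Rational.Properties as ℚP
import Data.Rational.Unnormalised as ℚᵘ
open import Data.Rational.Solver using (module +-*-Solver)
open import Data.Fin using (Fin; toℕ; fromℕ<)
open import Data.Fin.Properties using (toℕ-injective; toℕ-fromℕ<; toℕ<n)
open import Data.List using (List; []; _∷_; _++_; tabulate)
open import Data.List.Properties using (length-++; length-tabulate)
import Data.List.Relation.Unary.All as All
import Data.List.Relation.Unary.All.Properties as All
import Data.List.Relation.Unary.AllPairs as AllPairs
open import Data.List.Relation.Unary.Any using (here)
import Data.List.Relation.Unary.Unique.Propositional.Properties as Unique
open import Data.List.Membership.Propositional using (_∈_)
open import Data.List.Membership.Propositional.Properties using (∈-++⁺ˡ; ∈-++⁺ʳ; ∈-tabulate⁺)
open import Data.Product using (∃; ∃₂; _×_; _,_; proj₁; proj₂; swap)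
open import Data.Sum as Sum using (_⊎_; inj₁; inj₂; [_,_]′)
open import Data.Empty using (⊥; ⊥-elim)
open import Function using (id; _∘_; _∘₂_)
open import Relation.Nullary using (¬_; yes; no; contradiction)
open import Relation.Unary using (Pred; _≐_; _⊆_; _∪_; _∩_; Empty; ｛_｝)
open import Relation.Binary.PropositionalEquality

HasCard-cong : ∀ {P Q : Pred Pt _} {n} → P ≐ Q → HasCard P n → HasCard Q n
HasCard-cong (P⊆Q , Q⊆P) (l , len , uniq , all , complete) =
  l , len , uniq , All.map P⊆Q all , λ a qa → complete a (Q⊆P qa)

HasCard-singleton : ∀ a → HasCard ｛ a ｝ 1
HasCard-singleton a =
  a ∷ [] , refl , All.[] AllPairs.∷ AllPairs.[] , refl All.∷ All.[] , λ _ a≡b → here (sym a≡b)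

HasCard-∪ : ∀ {P Q : Pred Pt _} {m n} →
            Empty (P ∩ Q) → HasCard P m → HasCard Q n → HasCard (P ∪ Q) (m ℕ.+ n)
HasCard-∪ P∩Q=∅ (l₁ , len₁ , uniq₁ , all₁ , complete₁) (l₂ , len₂ , uniq₂ , all₂ , complete₂) =
  l₁ ++ l₂ ,
  trans (length-++ l₁) (cong₂ ℕ._+_ len₁ len₂) ,
  Unique.++⁺ uniq₁ uniq₂ (λ (a∈l₁ , a∈l₂) → P∩Q=∅ _ (All.lookup all₁ a∈l₁ , All.lookup all₂ a∈l₂)) ,
  All.++⁺ (All.map inj₁ all₁) (All.map inj₂ all₂) ,
  λ { a (inj₁ pa) → ∈-++⁺ˡ (complete₁ a pa) ; a (inj₂ qa) → ∈-++⁺ʳ l₁ (complete₂ a qa) }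

HasCard-tabulate : ∀ {P : Pred Pt _} {n} (f : Fin n → Pt) → (∀ {i j} → f i ≡ f j → i ≡ j) →
                   (∀ i → P (f i)) → (∀ {a} → P a → ∃ λ i → f i ≡ a) → HasCard P n
HasCard-tabulate f f-injective f∈P f-onto =
  tabulate f , length-tabulate f , Unique.tabulate⁺ f-injective , All.tabulate⁺ f∈P ,
  λ a pa → let i , fi≡a = f-onto pa in subst (_∈ tabulate f) fi≡a (∈-tabulate⁺ i)

HasCard-interval : ∀ {P : Pred Pt _} n (f : ℤ → Pt) (g : Pt → ℤ) →
                   (∀ {c} → ℤ.0ℤ ℤ.< c → c ℤ.≤ + n → P (f c)) →
                   (∀ {c} → ℤ.0ℤ ℤ.< c → c ℤ.≤ + n → g (f c) ≡ c) →
                   (∀ {a} → P a → ∃ λ c → ℤ.0ℤ ℤ.< c × c ℤ.≤ + n × f c ≡ a) →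
                   HasCard P n
HasCard-interval {P} n f g f∈P g∘f≗id onto =
  HasCard-tabulate (f ∘ index) index-injective (λ i → f∈P (0<index i) (index≤n i)) onto′
  where
  index : Fin n → ℤ
  index i = + suc (toℕ i)

  0<index : ∀ i → ℤ.0ℤ ℤ.< index i
  0<index i = ℤ.+<+ (ℕ.s≤s ℕ.z≤n)

  index≤n : ∀ i → index i ℤ.≤ + n
  index≤n i = ℤ.+≤+ (toℕ<n i)

  index-injective : ∀ {i j} → f (index i) ≡ f (index j) → i ≡ j
  index-injective {i} {j} eq = toℕ-injective (ℕP.suc-injective (ℤP.+-injective (begin
    index i         ≡⟨ g∘f≗id (0<index i) (index≤n i) ⟨
    g (f (index i)) ≡⟨ cong g eq ⟩
    g (f (index j)) ≡⟨ g∘f≗id (0<index j) (index≤n j) ⟩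
    index j         ∎)))
    where open ≡-Reasoning

  onto′ : ∀ {a} → P a → ∃ λ i → f (index i) ≡ a
  onto′ pa with onto pa
  ... | + suc k , _ , ℤ.+≤+ k<n , fc≡a =
    fromℕ< k<n , subst (λ m → f (+ suc m) ≡ _) (sym (toℕ-fromℕ< k<n)) fc≡a
  ... | + zero , ℤ.+<+ () , _

triangular : ℕ → ℕ
triangular zero    = 0
triangular (suc t) = suc t ℕ.+ triangular t

2*triangular : ∀ t → 2 ℕ.* triangular t ≡ t ℕ.+ t ℕ.* t
2*triangular zero    = refl
2*triangular (suc t) = begin
  2 ℕ.* (suc t ℕ.+ triangular t)        ≡⟨ ℕP.*-distribˡ-+ 2 (suc t) (triangular t) ⟩
  2 ℕ.* suc t ℕ.+ 2 ℕ.* triangular t    ≡⟨ cong (2 ℕ.* suc t ℕ.+_) (2*triangular t) ⟩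
  2 ℕ.* suc t ℕ.+ (t ℕ.+ t ℕ.* t)       ≡⟨ ℕ-Ring.solve (t ∷ []) ⟩
  suc t ℕ.+ suc t ℕ.* suc t             ∎
  where open ≡-Reasoning

ℤ→ℚ-mkℚ : ∀ n → ℤ→ℚ n ≡ mkℚ n 0 (coprime-sym (1-coprimeTo ℤ.∣ n ∣))
ℤ→ℚ-mkℚ (+ n)      = ℚP.normalize-coprime (coprime-sym (1-coprimeTo n))
ℤ→ℚ-mkℚ ℤ.-[1+ n ] = cong ℚ.-_ (ℚP.normalize-coprime (coprime-sym (1-coprimeTo (suc n))))

ℤ→ℚ-+ : ∀ a b → ℤ→ℚ (a ℤ.+ b) ≡ ℤ→ℚ a ℚ.+ ℤ→ℚ b
ℤ→ℚ-+ a b rewrite ℤ→ℚ-mkℚ a | ℤ→ℚ-mkℚ b | ℤP.*-identityʳ a | ℤP.*-identityʳ b = refl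

ℤ→ℚ-* : ∀ a b → ℤ→ℚ (a ℤ.* b) ≡ ℤ→ℚ a ℚ.* ℤ→ℚ b
ℤ→ℚ-* a b rewrite ℤ→ℚ-mkℚ a | ℤ→ℚ-mkℚ b = refl

ℤ→ℚ-neg : ∀ a → ℤ→ℚ (ℤ.- a) ≡ ℚ.- ℤ→ℚ a
ℤ→ℚ-neg (+ zero)   = refl
ℤ→ℚ-neg (+ suc n)  rewrite ℤ→ℚ-mkℚ (+ suc n) = refl
ℤ→ℚ-neg ℤ.-[1+ n ] rewrite ℤ→ℚ-mkℚ (+ suc n) = refl

↥ℤ→ℚ*↧ℤ→ℚ : ∀ a b → ℚ.↥ (ℤ→ℚ a) ℤ.* ℚ.↧ (ℤ→ℚ b) ≡ a
↥ℤ→ℚ*↧ℤ→ℚ a b rewrite ℤ→ℚ-mkℚ a | ℤ→ℚ-mkℚ b = ℤP.*-identityʳ a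

ℤ→ℚ-injective : ∀ {a b} → ℤ→ℚ a ≡ ℤ→ℚ b → a ≡ b
ℤ→ℚ-injective {a} {b} eq = begin
  a                               ≡⟨ ↥ℤ→ℚ*↧ℤ→ℚ a a ⟨
  ℚ.↥ (ℤ→ℚ a) ℤ.* ℚ.↧ (ℤ→ℚ a)     ≡⟨ cong (λ q → ℚ.↥ q ℤ.* ℚ.↧ q) eq ⟩
  ℚ.↥ (ℤ→ℚ b) ℤ.* ℚ.↧ (ℤ→ℚ b)     ≡⟨ ↥ℤ→ℚ*↧ℤ→ℚ b b ⟩
  b                               ∎
  where open ≡-Reasoning

ℤ→ℚ-mono-≤ : ∀ {a b} → a ℤ.≤ b → ℤ→ℚ a ℚ.≤ ℤ→ℚ b
ℤ→ℚ-mono-≤ {a} {b} a≤b = ℚ.*≤* (subst₂ ℤ._≤_ (sym (↥ℤ→ℚ*↧ℤ→ℚ a b)) (sym (↥ℤ→ℚ*↧ℤ→ℚ b a)) a≤b)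

ℤ→ℚ-cancel-≤ : ∀ {a b} → ℤ→ℚ a ℚ.≤ ℤ→ℚ b → a ℤ.≤ b
ℤ→ℚ-cancel-≤ {a} {b} (ℚ.*≤* a≤b) = subst₂ ℤ._≤_ (↥ℤ→ℚ*↧ℤ→ℚ a b) (↥ℤ→ℚ*↧ℤ→ℚ b a) a≤b

ℤ→ℚ-mono-< : ∀ {a b} → a ℤ.< b → ℤ→ℚ a ℚ.< ℤ→ℚ b
ℤ→ℚ-mono-< {a} {b} a<b = ℚ.*<* (subst₂ ℤ._<_ (sym (↥ℤ→ℚ*↧ℤ→ℚ a b)) (sym (↥ℤ→ℚ*↧ℤ→ℚ b a)) a<b)

ℤ→ℚ-cancel-< : ∀ {a b} → ℤ→ℚ a ℚ.< ℤ→ℚ b → a ℤ.< b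
ℤ→ℚ-cancel-< {a} {b} (ℚ.*<* a<b) = subst₂ ℤ._<_ (↥ℤ→ℚ*↧ℤ→ℚ a b) (↥ℤ→ℚ*↧ℤ→ℚ b a) a<b

/-≡-ℤ→ℚ : ∀ n d .{{_ : NonZero d}} q → n ≡ q ℤ.* + d → n / d ≡ ℤ→ℚ q
/-≡-ℤ→ℚ n (suc d) q n≡qd =
  ℚP.fromℚᵘ-cong {ℚᵘ.mkℚᵘ n d} {ℚᵘ.mkℚᵘ q 0} (ℚᵘ.*≡* (trans (ℤP.*-identityʳ n) n≡qd))

ℕ→ℚ-+ : ∀ m n → ℤ→ℚ (+ (m ℕ.+ n)) ≡ ℤ→ℚ (+ m) ℚ.+ ℤ→ℚ (+ n)
ℕ→ℚ-+ m n = trans (cong ℤ→ℚ (ℤP.pos-+ m n)) (ℤ→ℚ-+ (+ m) (+ n))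

ℕ→ℚ-* : ∀ m n → ℤ→ℚ (+ (m ℕ.* n)) ≡ ℤ→ℚ (+ m) ℚ.* ℤ→ℚ (+ n)
ℕ→ℚ-* m n = trans (cong ℤ→ℚ (ℤP.pos-* m n)) (ℤ→ℚ-* (+ m) (+ n))

½ : ℚ
½ = + 1 / 2

triangular-ℚ : ∀ t → let T = ℤ→ℚ (+ t) in ℤ→ℚ (+ triangular t) ≡ ½ ℚ.* (T ℚ.+ T ℚ.* T)
triangular-ℚ t = begin
  ℤ→ℚ (+ triangular t)                        ≡⟨ ℚP.*-identityˡ (ℤ→ℚ (+ triangular t)) ⟨
  1ℚ ℚ.* ℤ→ℚ (+ triangular t)                  ≡⟨⟩
  ½ ℚ.* ℤ→ℚ (+ 2) ℚ.* ℤ→ℚ (+ triangular t)     ≡⟨ ℚP.*-assoc ½ (ℤ→ℚ (+ 2)) (ℤ→ℚ (+ triangular t)) ⟩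
  ½ ℚ.* (ℤ→ℚ (+ 2) ℚ.* ℤ→ℚ (+ triangular t))   ≡⟨ cong (½ ℚ.*_) (ℕ→ℚ-* 2 (triangular t)) ⟨
  ½ ℚ.* ℤ→ℚ (+ (2 ℕ.* triangular t))           ≡⟨ cong (λ n → ½ ℚ.* ℤ→ℚ (+ n)) (2*triangular t) ⟩
  ½ ℚ.* ℤ→ℚ (+ (t ℕ.+ t ℕ.* t))                ≡⟨ cong (½ ℚ.*_) (ℕ→ℚ-+ t (t ℕ.* t)) ⟩
  ½ ℚ.* (T ℚ.+ ℤ→ℚ (+ (t ℕ.* t)))              ≡⟨ cong (λ u → ½ ℚ.* (T ℚ.+ u)) (ℕ→ℚ-* t t) ⟩
  ½ ℚ.* (T ℚ.+ T ℚ.* T)                        ∎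
  where
  open ≡-Reasoning
  T : ℚ
  T = ℤ→ℚ (+ t)

ehrhart : ℕ → List ℚ
ehrhart b = 1ℚ ∷ ℤ→ℚ (+ b) ℚ.* ½ ∷ ℤ→ℚ (+ b) ℚ.* ½ ∷ []

lattice-count-polynomial : ∀ b t → ℤ→ℚ (+ (1 ℕ.+ b ℕ.* triangular t)) ≡ evalPoly (ehrhart b) (ℤ→ℚ (+ t))
lattice-count-polynomial b t = begin
  ℤ→ℚ (+ (1 ℕ.+ b ℕ.* triangular t))     ≡⟨ ℕ→ℚ-+ 1 (b ℕ.* triangular t) ⟩
  1ℚ ℚ.+ ℤ→ℚ (+ (b ℕ.* triangular t))    ≡⟨ cong (1ℚ ℚ.+_) (ℕ→ℚ-* b (triangular t)) ⟩
  1ℚ ℚ.+ B ℚ.* ℤ→ℚ (+ triangular t)      ≡⟨ cong (λ u → 1ℚ ℚ.+ B ℚ.* u) (triangular-ℚ t) ⟩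
  1ℚ ℚ.+ B ℚ.* (½ ℚ.* (T ℚ.+ T ℚ.* T))    ≡⟨ horner B ½ T ⟩
  evalPoly (ehrhart b) T                  ∎
  where
  open ≡-Reasoning
  open +-*-Solver using (solve; con; _:+_; _:*_; _:=_)
  B T : ℚ
  B = ℤ→ℚ (+ b)
  T = ℤ→ℚ (+ t)
  horner : ∀ B h T → 1ℚ ℚ.+ B ℚ.* (h ℚ.* (T ℚ.+ T ℚ.* T))
                   ≡ 1ℚ ℚ.+ T ℚ.* (B ℚ.* h ℚ.+ T ℚ.* (B ℚ.* h ℚ.+ T ℚ.* 0ℚ))
  horner = solve 3 (λ B h T → con 1ℚ :+ B :* (h :* (T :+ T :* T))
                            := con 1ℚ :+ T :* (B :* h :+ T :* (B :* h :+ T :* con 0ℚ))) refl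

module RootTriples where

  open import Data.Nat
  open import Data.Nat.Properties
  open import Data.Nat.Divisibility using (_∣_; _∣?_)
  open import Data.Nat.Tactic.RingSolver using (solve)
  open import Relation.Nullary.Decidable using (Dec; from-yes; _×-dec_; _→-dec_)

  ≤-by-slack : ∀ {m n} k → m + k ≡ n → m ≤ n
  ≤-by-slack {m} k refl = m≤m+n m k

  -- The cone x ≤ y ≤ z ≤ x + y is freely parametrised by x = d + f, y = x + e, z = y + d, so each
  -- inequality below is witnessed by a polynomial slack with nonnegative coefficients.
  cone-coordinates : ∀ {x y z} → x ≤ y → y ≤ z → z ≤ x + y →
                     ∃₂ λ d e → ∃ λ f → x ≡ d + f × y ≡ x + e × z ≡ y + d
  cone-coordinates {x} {y} {z} x≤y y≤z z≤x+y
    with m≤n⇒∃[o]m+o≡n x≤y | m≤n⇒∃[o]m+o≡n y≤z | m≤n⇒∃[o]m+o≡n z≤x+y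
  ... | e , x+e≡y | d , y+d≡z | f , z+f≡x+y = d , e , f , x≡d+f , sym x+e≡y , sym y+d≡z
    where
    x≡d+f : x ≡ d + f
    x≡d+f = +-cancelˡ-≡ y x (d + f) (begin
      y + x         ≡⟨ +-comm y x ⟩
      x + y         ≡⟨ z+f≡x+y ⟨
      z + f         ≡⟨ cong (_+ f) y+d≡z ⟨
      y + d + f     ≡⟨ +-assoc y d f ⟩
      y + (d + f)   ∎)
      where open ≡-Reasoning

  square≤10yz : ∀ d e f → let x = d + f ; y = x + e ; z = y + d in
                (x + y + z) * (x + y + z) ≤ 10 * (y * z)
  square≤10yz d e f = ≤-by-slack (14 * d * e + 6 * d * f + 4 * d * d + 8 * e * f + 6 * e * e + f * f)
                                 (solve (d ∷ e ∷ f ∷ []))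

  4yz+x²≤square : ∀ d e f → let x = d + f ; y = x + e ; z = y + d in
                  4 * (y * z) + x * x ≤ (x + y + z) * (x + y + z)
  4yz+x²≤square d e f = ≤-by-slack (7 * d * d + 10 * d * f + 4 * f * f + 4 * d * e + 4 * e * f)
                                   (solve (d ∷ e ∷ f ∷ []))

  square+x²≤5yz : ∀ d f k → let x = d + f ; y = x + (8 * x + k) ; z = y + d in
                  (x + y + z) * (x + y + z) + x * x ≤ 5 * (y * z)
  square+x²≤5yz d f k = ≤-by-slack (93 * d * f + 15 * d * k + 49 * d * d + 14 * f * k + 43 * f * f + k * k)
                                   (solve (d ∷ f ∷ k ∷ []))

  root-bounds : ∀ {b} d e f → let x = d + f ; y = x + e ; z = y + d in
                0 < x → (x + y + z) * (x + y + z) ≡ b * x * y * z → 5 ≤ b * x × b * x ≤ 10 × e < 8 * x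
  root-bounds {b} d e f 0<x markov = 5≤bx , bx≤10 , e<8x
    where
    x y z : ℕ
    x = d + f
    y = x + e
    z = y + d

    instance
      y≢0 : NonZero y
      y≢0 = >-nonZero (<-≤-trans 0<x (m≤m+n x e))
      z≢0 : NonZero z
      z≢0 = >-nonZero (<-≤-trans (>-nonZero⁻¹ y) (m≤m+n y d))
      yz≢0 : NonZero (y * z)
      yz≢0 = m*n≢0 y z

    0<x² : 0 < x * x
    0<x² = >-nonZero⁻¹ (x * x) {{m*n≢0 x x {{>-nonZero 0<x}} {{>-nonZero 0<x}}}}

    square≡bx*yz : (x + y + z) * (x + y + z) ≡ b * x * (y * z)
    square≡bx*yz = trans markov (*-assoc (b * x) y z)

    bx≤10 : b * x ≤ 10
    bx≤10 = *-cancelʳ-≤ (b * x) 10 (y * z) (subst (_≤ 10 * (y * z)) square≡bx*yz (square≤10yz d e f))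

    5≤bx : 5 ≤ b * x
    5≤bx = *-cancelʳ-< (y * z) 4 (b * x) (begin-strict
      4 * (y * z)                  <⟨ m<m+n (4 * (y * z)) 0<x² ⟩
      4 * (y * z) + x * x          ≤⟨ 4yz+x²≤square d e f ⟩
      (x + y + z) * (x + y + z)    ≡⟨ square≡bx*yz ⟩
      b * x * (y * z)              ∎)
      where open ≤-Reasoning

    e<8x : e < 8 * x
    e<8x with e <? 8 * x
    ... | yes e<8x = e<8x
    ... | no e≮8x with m≤n⇒∃[o]m+o≡n (≮⇒≥ e≮8x)
    ...   | k , refl = contradiction (square+x²≤5yz d f k) (<⇒≱ (begin-strict
      5 * (y * z)                          ≤⟨ *-monoˡ-≤ (y * z) 5≤bx ⟩
      b * x * (y * z)                      ≡⟨ square≡bx*yz ⟨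
      (x + y + z) * (x + y + z)            <⟨ m<m+n _ 0<x² ⟩
      (x + y + z) * (x + y + z) + x * x    ∎))
      where open ≤-Reasoning

  RootDivisible : ℕ → ℕ → ℕ → ℕ → Set
  RootDivisible b x e d = let y = x + e ; z = y + d in
    (x + y + z) * (x + y + z) ≡ b * x * y * z → x ∣ y + z × x ∣ b * y × x ∣ b * z

  root-divisible? : ∀ b x e d → Dec (RootDivisible b x e d)
  root-divisible? b x e d = let y = x + e ; z = y + d in
    ((x + y + z) * (x + y + z) ≟ b * x * y * z) →-dec ((x ∣? y + z) ×-dec (x ∣? b * y) ×-dec (x ∣? b * z))

  root-table : ∀ {b} → b < 11 → ∀ {x} → x < 11 → 5 ≤ b * x → b * x ≤ 10 →
               ∀ {e} → e < 8 * x → ∀ {d} → d < suc x → RootDivisible b x e d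
  root-table = from-yes (allUpTo? (λ b → allUpTo? (λ x → (5 ≤? b * x) →-dec (b * x ≤? 10) →-dec
                 allUpTo? (λ e → allUpTo? (root-divisible? b x e) (suc x)) (8 * x)) 11) 11)

  cone-root-divisible : ∀ {b} d e f → let x = d + f ; y = x + e ; z = y + d in
                        0 < x → (x + y + z) * (x + y + z) ≡ b * x * y * z →
                        x ∣ y + z × x ∣ b * y × x ∣ b * z
  cone-root-divisible {b} d e f 0<x markov = root-table b<11 x<11 5≤bx bx≤10 e<8x (s≤s (m≤m+n d f)) markov
    where
    x : ℕ
    x = d + f

    bounds : 5 ≤ b * x × b * x ≤ 10 × e < 8 * x
    bounds = root-bounds {b} d e f 0<x markov

    5≤bx : 5 ≤ b * x
    5≤bx = proj₁ bounds
    bx≤10 : b * x ≤ 10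
    bx≤10 = proj₁ (proj₂ bounds)
    e<8x : e < 8 * x
    e<8x = proj₂ (proj₂ bounds)

    instance
      bx≢0 : NonZero (b * x)
      bx≢0 = >-nonZero (≤-trans (s≤s z≤n) 5≤bx)
      b≢0 : NonZero b
      b≢0 = m*n≢0⇒m≢0 b
      x≢0 : NonZero x
      x≢0 = >-nonZero 0<x

    b<11 : b < 11
    b<11 = s≤s (≤-trans (m≤m*n b x) bx≤10)
    x<11 : x < 11
    x<11 = s≤s (≤-trans (m≤n*m x b) bx≤10)

  root-divisible : ∀ {b x y z} → 0 < x → x ≤ y → y ≤ z → z ≤ x + y →
                   (x + y + z) * (x + y + z) ≡ b * x * y * z → x ∣ y + z × x ∣ b * y × x ∣ b * z
  root-divisible {b} 0<x x≤y y≤z z≤x+y with cone-coordinates x≤y y≤z z≤x+y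
  ... | d , e , f , refl , refl , refl = cone-root-divisible {b} d e f 0<x

open RootTriples using (root-divisible)

module LatticeTriangles where

  open import Data.Integer using (ℤ; +_; 0ℤ; 1ℤ; -1ℤ; _+_; _-_; _*_; -_; _≤_; _<_; _≤?_; _≟_; +<+)
  open import Data.Integer.Base using (positive; nonNegative; >-nonZero)
  open import Data.Integer.Divisibility.Signed using (_∣_; divides; ∣-refl; ∣n⇒∣m*n; ∣m∣n⇒∣m-n; ∣ᵤ⇒∣)
  open import Data.Integer.Tactic.RingSolver using (solve)
  open import Algebra.Properties.AbelianGroup ℤP.+-0-abelianGroup using (∙-cancelʳ)

  -- a ≡ b follows from c ≡ d once a + c ≡ b + d is a ring identity (cf. Lean's linear_combination).
  -- Such identities are proved by solve, which treats defined names as opaque constants; hence they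
  -- are stated below with v · a and the edge points unfolded.
  linear-combination : ∀ {a b c d} → c ≡ d → a + c ≡ b + d → a ≡ b
  linear-combination {a} {b} {c} refl a+c≡b+c = ∙-cancelʳ c a b a+c≡b+c

  ≤-from-slack : ∀ {v s d} → s - v ≡ d → 0ℤ ≤ d → v ≤ s
  ≤-from-slack refl = ℤP.0≤i-j⇒j≤i

  <-from-slack : ∀ {v s d} → s - v ≡ d → 0ℤ < d → v < s
  <-from-slack {v} {s} refl 0<s-v = subst₂ _<_ (ℤP.+-identityʳ v) v+[s-v]≡s (ℤP.+-monoʳ-< v 0<s-v)
    where
    v+[s-v]≡s : v + (s - v) ≡ s
    v+[s-v]≡s = solve (s ∷ v ∷ [])

  ≢-from-slack : ∀ {v s d} → s - v ≡ d → 0ℤ < d → v ≢ s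
  ≢-from-slack s-v≡d 0<d = ℤP.<⇒≢ (<-from-slack s-v≡d 0<d)

  slack-nonNeg : ∀ {v s d} → s - v ≡ d → v ≤ s → 0ℤ ≤ d
  slack-nonNeg refl = ℤP.i≤j⇒0≤j-i

  slack-pos : ∀ {v s d} → s - v ≡ d → v < s → 0ℤ < d
  slack-pos {v} {s} refl v<s = subst (_< s - v) (ℤP.+-inverseʳ v) (ℤP.+-monoˡ-< (- v) v<s)

  i<i+j : ∀ i {j} → 0ℤ < j → i < i + j
  i<i+j i 0<j = subst (_< i + _) (ℤP.+-identityʳ i) (ℤP.+-monoʳ-< i 0<j)

  *-monoˡ-≤-pos : ∀ {a b c} → 0ℤ < a → b ≤ c → a * b ≤ a * c
  *-monoˡ-≤-pos {a} 0<a = ℤP.*-monoˡ-≤-nonNeg a {{nonNegative (ℤP.<⇒≤ 0<a)}}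

  *-cancelˡ-<-pos : ∀ {a b c} → 0ℤ < a → a * b < a * c → b < c
  *-cancelˡ-<-pos {a} 0<a = ℤP.*-cancelˡ-<-nonNeg a {{nonNegative (ℤP.<⇒≤ 0<a)}}

  *-cancelˡ-≡-pos : ∀ {a b c} → 0ℤ < a → a * b ≡ a * c → b ≡ c
  *-cancelˡ-≡-pos {a} {b} {c} 0<a = ℤP.*-cancelˡ-≡ a b c {{>-nonZero 0<a}}

  *-pos : ∀ {a b} → 0ℤ < a → 0ℤ < b → 0ℤ < a * b
  *-pos {a} {b} 0<a 0<b = subst (_< a * b) (ℤP.*-zeroʳ a) (ℤP.*-monoˡ-<-pos a {{positive 0<a}} 0<b)

  *-pos-nonNeg : ∀ {a b} → 0ℤ < a → 0ℤ ≤ b → 0ℤ ≤ a * b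
  *-pos-nonNeg {a} {b} 0<a 0≤b = subst (_≤ a * b) (ℤP.*-zeroʳ a) (*-monoˡ-≤-pos 0<a 0≤b)

  *-pos-nonPos : ∀ {a b} → 0ℤ < a → b ≤ 0ℤ → a * b ≤ 0ℤ
  *-pos-nonPos {a} {b} 0<a b≤0 = subst (a * b ≤_) (ℤP.*-zeroʳ a) (*-monoˡ-≤-pos 0<a b≤0)

  *-pos⁻¹ : ∀ {a b} → 0ℤ < a → 0ℤ < a * b → 0ℤ < b
  *-pos⁻¹ {a} {b} 0<a 0<ab = *-cancelˡ-<-pos 0<a (subst (_< a * b) (sym (ℤP.*-zeroʳ a)) 0<ab)

  *-nonNeg⁻¹ : ∀ {a b} → 0ℤ < a → 0ℤ ≤ a * b → 0ℤ ≤ b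
  *-nonNeg⁻¹ {a} {b} 0<a 0≤ab =
    ℤP.*-cancelˡ-≤-pos 0ℤ b a {{positive 0<a}} (subst (_≤ a * b) (sym (ℤP.*-zeroʳ a)) 0≤ab)

  *-≡0-pos : ∀ {a b} → 0ℤ < a → a * b ≡ 0ℤ → b ≡ 0ℤ
  *-≡0-pos {a} 0<a ab≡0 = *-cancelˡ-≡-pos 0<a (trans ab≡0 (sym (ℤP.*-zeroʳ a)))

  nonPos+nonPos≡0 : ∀ {a b} → a ≤ 0ℤ → b ≤ 0ℤ → a + b ≡ 0ℤ → a ≡ 0ℤ × b ≡ 0ℤ
  nonPos+nonPos≡0 {a} {b} a≤0 b≤0 a+b≡0 =
    ℤP.≤-antisym a≤0 (subst₂ _≤_ a+b≡0 (ℤP.+-identityʳ a) (ℤP.+-monoʳ-≤ a b≤0)) ,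
    ℤP.≤-antisym b≤0 (subst₂ _≤_ a+b≡0 (ℤP.+-identityˡ b) (ℤP.+-monoˡ-≤ b a≤0))

  _·_ : Pt → Pt → ℤ
  (α , β) · (p , q) = α * p + β * q

  ·-zeroʳ : ∀ v → v · (0ℤ , 0ℤ) ≡ 0ℤ
  ·-zeroʳ (α , β) = cong₂ _+_ (ℤP.*-zeroʳ α) (ℤP.*-zeroʳ β)

  ⟪emb,emb⟫ : ∀ v a → ⟪ emb v , emb a ⟫ ≡ ℤ→ℚ (v · a)
  ⟪emb,emb⟫ (α , β) (p , q) = sym (trans (ℤ→ℚ-+ (α * p) (β * q)) (cong₂ ℚ._+_ (ℤ→ℚ-* α p) (ℤ→ℚ-* β q)))

  -- M = (x + y + z)/x and r = bz/x, so that u₁ = (y, (y + z)/x) becomes v₁ = (y, M − 1).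
  module Triangle
    (b x y z M r : ℤ) (0<x : 0ℤ < x) (0<y : 0ℤ < y) (0<z : 0ℤ < z)
    (x+y+z≡Mx : x + y + z ≡ M * x)
    (markov : (x + y + z) * (x + y + z) ≡ b * x * y * z)
    (bz≡rx : b * z ≡ r * x)
    where

    vars : List ℤ
    vars = b ∷ x ∷ y ∷ z ∷ M ∷ r ∷ []

    xM²≡byz : x * (M * M) ≡ b * (y * z)
    xM²≡byz = *-cancelˡ-≡-pos 0<x (begin
      x * (x * (M * M))            ≡⟨ solve vars ⟩
      (M * x) * (M * x)            ≡⟨ cong₂ _*_ x+y+z≡Mx x+y+z≡Mx ⟨
      (x + y + z) * (x + y + z)    ≡⟨ markov ⟩
      b * x * y * z                ≡⟨ solve vars ⟩
      x * (b * (y * z))            ∎)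
      where open ≡-Reasoning

    yr≡M² : y * r ≡ M * M
    yr≡M² = *-cancelˡ-≡-pos 0<x (begin
      x * (y * r)                  ≡⟨ solve vars ⟩
      y * (r * x)                  ≡⟨ cong (y *_) bz≡rx ⟨
      y * (b * z)                  ≡⟨ solve vars ⟩
      b * (y * z)                  ≡⟨ xM²≡byz ⟨
      x * (M * M)                  ∎)
      where open ≡-Reasoning

    0<M : 0ℤ < M
    0<M = ℤP.*-cancelʳ-<-nonNeg x {{nonNegative (ℤP.<⇒≤ 0<x)}}
            (subst (0ℤ <_) x+y+z≡Mx (ℤP.+-mono-< (ℤP.+-mono-< 0<x 0<y) 0<z))

    v₁ v₂ v₃ : Pt
    v₁ = y , M - 1ℤ
    v₂ = - x , -1ℤ
    v₃ = 0ℤ , -1ℤ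

    Dilate : ℤ → Pt → Set
    Dilate s a = v₁ · a ≤ s × v₂ · a ≤ s × v₃ · a ≤ s

    Boundary : ℤ → Pt → Set
    Boundary s a = Dilate s a × (v₁ · a ≡ s ⊎ v₂ · a ≡ s ⊎ v₃ · a ≡ s)

    normals-balanced : ∀ a → x * (v₁ · a) + y * (v₂ · a) + z * (v₃ · a) ≡ 0ℤ
    normals-balanced (p , q) = linear-combination (cong (q *_) x+y+z≡Mx) identity
      where
      identity : x * (y * p + (M - 1ℤ) * q) + y * (- x * p + -1ℤ * q) + z * (0ℤ * p + -1ℤ * q) + q * (x + y + z)
               ≡ 0ℤ + q * (M * x)
      identity = solve (p ∷ q ∷ vars)

    origin∈Dilate₀ : Dilate 0ℤ (0ℤ , 0ℤ)
    origin∈Dilate₀ = ℤP.≤-reflexive (·-zeroʳ v₁) , ℤP.≤-reflexive (·-zeroʳ v₂) , ℤP.≤-reflexive (·-zeroʳ v₃)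

    dilate₀-origin : ∀ {a} → Dilate 0ℤ a → a ≡ (0ℤ , 0ℤ)
    dilate₀-origin {p , q} (α≤0 , β≤0 , γ≤0) = cong₂ _,_ p≡0 q≡0
      where
      xα≤0 : x * (v₁ · (p , q)) ≤ 0ℤ
      xα≤0 = *-pos-nonPos 0<x α≤0
      yβ≤0 : y * (v₂ · (p , q)) ≤ 0ℤ
      yβ≤0 = *-pos-nonPos 0<y β≤0

      xα+yβ≡0×zγ≡0 : x * (v₁ · (p , q)) + y * (v₂ · (p , q)) ≡ 0ℤ × z * (v₃ · (p , q)) ≡ 0ℤ
      xα+yβ≡0×zγ≡0 = nonPos+nonPos≡0 (ℤP.+-mono-≤ xα≤0 yβ≤0) (*-pos-nonPos 0<z γ≤0) (normals-balanced (p , q))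

      β≡0 : v₂ · (p , q) ≡ 0ℤ
      β≡0 = *-≡0-pos 0<y (proj₂ (nonPos+nonPos≡0 xα≤0 yβ≤0 (proj₁ xα+yβ≡0×zγ≡0)))

      q≡0 : q ≡ 0ℤ
      q≡0 = linear-combination (*-≡0-pos 0<z (proj₂ xα+yβ≡0×zγ≡0)) identity
        where
        identity : q + (0ℤ * p + -1ℤ * q) ≡ 0ℤ + 0ℤ
        identity = solve (p ∷ q ∷ [])

      p≡0 : p ≡ 0ℤ
      p≡0 = *-≡0-pos 0<x (linear-combination (trans β≡0 (cong -_ (sym q≡0))) identity)
        where
        identity : x * p + (- x * p + -1ℤ * q) ≡ 0ℤ + - q
        identity = solve (p ∷ q ∷ vars)

    origin≐Dilate₀ : ｛ (0ℤ , 0ℤ) ｝ ≐ Dilate 0ℤ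
    origin≐Dilate₀ = (λ { refl → origin∈Dilate₀ }) , sym ∘ dilate₀-origin

    edge-ranges-disjoint : ∀ {s c} → 0ℤ < s → z * c ≤ s * M → y * (b * s - c) ≤ s * M → ⊥
    edge-ranges-disjoint {s} {c} 0<s zc≤sM yv≤sM = ℤP.<-irrefl refl (begin-strict
      y * z * (b * s)                         ≡⟨ solve (s ∷ c ∷ vars) ⟩
      y * (z * c) + z * (y * (b * s - c))     ≤⟨ ℤP.+-mono-≤ (*-monoˡ-≤-pos 0<y zc≤sM) (*-monoˡ-≤-pos 0<z yv≤sM) ⟩
      y * (s * M) + z * (s * M)               <⟨ i<i+j _ (*-pos 0<s (*-pos 0<x 0<M)) ⟩
      y * (s * M) + z * (s * M) + s * (x * M) ≡⟨ solve (s ∷ vars) ⟩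
      s * M * (x + y + z)                     ≡⟨ cong (s * M *_) x+y+z≡Mx ⟩
      s * M * (M * x)                         ≡⟨ solve (s ∷ vars) ⟩
      s * (x * (M * M))                       ≡⟨ cong (s *_) xM²≡byz ⟩
      s * (b * (y * z))                       ≡⟨ solve (s ∷ vars) ⟩
      y * z * (b * s)                         ∎)
      where open ℤP.≤-Reasoning

    -- Edge i of sT is where vᵢ · a = s. The boundary lattice points are boundary-point c for
    -- c ∈ (0, bs]: on edge 2 while zc ≤ sM, on edge 3 while y(bs − c) ≤ sM, on edge 1 in between.
    module Layer (s : ℤ) (0<s : 0ℤ < s) where

      edge₁-point edge₂-point edge₃-point : ℤ → Pt
      edge₁-point c = s * r + (M - 1ℤ) * (c - b * s) , - (s * (M + 1ℤ)) - y * (c - b * s)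
      edge₂-point c = - c , x * c - s
      edge₃-point c = b * s - c , - s

      edge₁-on₁ : ∀ c → v₁ · edge₁-point c ≡ s
      edge₁-on₁ c = linear-combination (cong (s *_) (sym yr≡M²)) identity
        where
        identity : y * (s * r + (M - 1ℤ) * (c - b * s)) + (M - 1ℤ) * (- (s * (M + 1ℤ)) - y * (c - b * s))
                     + s * (M * M)
                 ≡ s + s * (y * r)
        identity = solve (s ∷ c ∷ vars)

      edge₁-slack₂ : ∀ c → s - v₂ · edge₁-point c ≡ z * c - s * M
      edge₁-slack₂ c =
        linear-combination (cong₂ _+_ (cong ((c - b * s) *_) x+y+z≡Mx) (cong (s *_) bz≡rx)) identity
        where
        identity : s - (- x * (s * r + (M - 1ℤ) * (c - b * s)) + -1ℤ * (- (s * (M + 1ℤ)) - y * (c - b * s)))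
                     + ((c - b * s) * (x + y + z) + s * (b * z))
                 ≡ z * c - s * M + ((c - b * s) * (M * x) + s * (r * x))
        identity = solve (s ∷ c ∷ vars)

      edge₁-slack₃ : ∀ c → s - v₃ · edge₁-point c ≡ y * (b * s - c) - s * M
      edge₁-slack₃ c = identity
        where
        identity : s - (0ℤ * (s * r + (M - 1ℤ) * (c - b * s)) + -1ℤ * (- (s * (M + 1ℤ)) - y * (c - b * s)))
                 ≡ y * (b * s - c) - s * M
        identity = solve (s ∷ c ∷ vars)

      edge₂-slack₁ : ∀ c → s - v₁ · edge₂-point c ≡ s * M - z * c
      edge₂-slack₁ c = linear-combination (cong (c *_) (sym x+y+z≡Mx)) identity
        where
        identity : s - (y * - c + (M - 1ℤ) * (x * c - s)) + c * (M * x) ≡ s * M - z * c + c * (x + y + z)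
        identity = solve (s ∷ c ∷ vars)

      edge₂-on₂ : ∀ c → v₂ · edge₂-point c ≡ s
      edge₂-on₂ c = identity
        where
        identity : - x * - c + -1ℤ * (x * c - s) ≡ s
        identity = solve (s ∷ c ∷ vars)

      edge₂-slack₃ : ∀ c → s - v₃ · edge₂-point c ≡ x * c
      edge₂-slack₃ c = identity
        where
        identity : s - (0ℤ * - c + -1ℤ * (x * c - s)) ≡ x * c
        identity = solve (s ∷ c ∷ vars)

      edge₃-slack₁ : ∀ c → s - v₁ · edge₃-point c ≡ s * M - y * (b * s - c)
      edge₃-slack₁ c = identity
        where
        identity : s - (y * (b * s - c) + (M - 1ℤ) * - s) ≡ s * M - y * (b * s - c)
        identity = solve (s ∷ c ∷ vars)

      edge₃-slack₂ : ∀ c → s - v₂ · edge₃-point c ≡ x * (b * s - c)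
      edge₃-slack₂ c = identity
        where
        identity : s - (- x * (b * s - c) + -1ℤ * - s) ≡ x * (b * s - c)
        identity = solve (s ∷ c ∷ vars)

      edge₃-on₃ : ∀ c → v₃ · edge₃-point c ≡ s
      edge₃-on₃ c = identity
        where
        identity : 0ℤ * (b * s - c) + -1ℤ * - s ≡ s
        identity = solve (s ∷ c ∷ vars)

      0<sM : 0ℤ < s * M
      0<sM = *-pos 0<s 0<M

      pos*nonPos≤sM : ∀ {u v} → 0ℤ < u → v ≤ 0ℤ → u * v ≤ s * M
      pos*nonPos≤sM 0<u v≤0 = ℤP.≤-trans (*-pos-nonPos 0<u v≤0) (ℤP.<⇒≤ 0<sM)

      param-pos : ∀ {c} → ¬ (z * c ≤ s * M) → 0ℤ < c
      param-pos zc≰sM = ℤP.≰⇒> (λ c≤0 → zc≰sM (pos*nonPos≤sM 0<z c≤0))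

      param≤bs : ∀ {c} → ¬ (y * (b * s - c) ≤ s * M) → c ≤ b * s
      param≤bs yv≰sM = ℤP.≮⇒≥ (λ bs<c → yv≰sM (pos*nonPos≤sM 0<y (ℤP.i≤j⇒i-j≤0 (ℤP.<⇒≤ bs<c))))

      boundary-point : ℤ → Pt
      boundary-point c with z * c ≤? s * M | y * (b * s - c) ≤? s * M
      ... | yes _ | _     = edge₂-point c
      ... | no _  | yes _ = edge₃-point c
      ... | no _  | no _  = edge₁-point c

      boundary-point-edge₁ : ∀ {c} → s * M < z * c → s * M < y * (b * s - c) → boundary-point c ≡ edge₁-point c
      boundary-point-edge₁ {c} sM<zc sM<yv with z * c ≤? s * M | y * (b * s - c) ≤? s * M
      ... | yes zc≤sM | _         = ⊥-elim (ℤP.<⇒≱ sM<zc zc≤sM)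
      ... | no _      | yes yv≤sM = ⊥-elim (ℤP.<⇒≱ sM<yv yv≤sM)
      ... | no _      | no _      = refl

      boundary-point-edge₂ : ∀ {c} → z * c ≤ s * M → boundary-point c ≡ edge₂-point c
      boundary-point-edge₂ {c} zc≤sM with z * c ≤? s * M
      ... | yes _    = refl
      ... | no zc≰sM = ⊥-elim (zc≰sM zc≤sM)

      boundary-point-edge₃ : ∀ {c} → y * (b * s - c) ≤ s * M → boundary-point c ≡ edge₃-point c
      boundary-point-edge₃ {c} yv≤sM with z * c ≤? s * M | y * (b * s - c) ≤? s * M
      ... | yes zc≤sM | _        = ⊥-elim (edge-ranges-disjoint 0<s zc≤sM yv≤sM)
      ... | no _      | yes _    = refl
      ... | no _      | no yv≰sM = ⊥-elim (yv≰sM yv≤sM)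

      edge₁-point∈Boundary : ∀ {c} → s * M < z * c → s * M < y * (b * s - c) → Boundary s (edge₁-point c)
      edge₁-point∈Boundary {c} sM<zc sM<yv =
        (ℤP.≤-reflexive (edge₁-on₁ c) ,
         ≤-from-slack (edge₁-slack₂ c) (ℤP.<⇒≤ (slack-pos refl sM<zc)) ,
         ≤-from-slack (edge₁-slack₃ c) (ℤP.<⇒≤ (slack-pos refl sM<yv))) ,
        inj₁ (edge₁-on₁ c)

      edge₂-point∈Boundary : ∀ {c} → 0ℤ < c → z * c ≤ s * M → Boundary s (edge₂-point c)
      edge₂-point∈Boundary {c} 0<c zc≤sM =
        (≤-from-slack (edge₂-slack₁ c) (ℤP.i≤j⇒0≤j-i zc≤sM) ,
         ℤP.≤-reflexive (edge₂-on₂ c) ,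
         ≤-from-slack (edge₂-slack₃ c) (ℤP.<⇒≤ (*-pos 0<x 0<c))) ,
        inj₂ (inj₁ (edge₂-on₂ c))

      edge₃-point∈Boundary : ∀ {c} → c ≤ b * s → y * (b * s - c) ≤ s * M → Boundary s (edge₃-point c)
      edge₃-point∈Boundary {c} c≤bs yv≤sM =
        (≤-from-slack (edge₃-slack₁ c) (ℤP.i≤j⇒0≤j-i yv≤sM) ,
         ≤-from-slack (edge₃-slack₂ c) (*-pos-nonNeg 0<x (ℤP.i≤j⇒0≤j-i c≤bs)) ,
         ℤP.≤-reflexive (edge₃-on₃ c)) ,
        inj₂ (inj₂ (edge₃-on₃ c))

      -- On edge 1, a step (M − 1, −y) of edge₁-point changes bs − (M + 1)p − rq by
      -- ry − (M + 1)(M − 1) = 1, as yr = M².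
      boundary-index : Pt → ℤ
      boundary-index (p , q) with v₃ · (p , q) ≟ s | v₂ · (p , q) ≟ s
      ... | yes _ | _     = b * s - p
      ... | no _  | yes _ = - p
      ... | no _  | no _  = b * s - (M + 1ℤ) * p - r * q

      index-edge₁ : ∀ {c} → s * M < z * c → s * M < y * (b * s - c) → boundary-index (edge₁-point c) ≡ c
      index-edge₁ {c} sM<zc sM<yv with v₃ · edge₁-point c ≟ s | v₂ · edge₁-point c ≟ s
      ... | yes on₃ | _       = ⊥-elim (≢-from-slack (edge₁-slack₃ c) (slack-pos refl sM<yv) on₃)
      ... | no _    | yes on₂ = ⊥-elim (≢-from-slack (edge₁-slack₂ c) (slack-pos refl sM<zc) on₂)
      ... | no _    | no _    = linear-combination (cong ((c - b * s) *_) (sym yr≡M²)) identity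
        where
        identity : b * s - (M + 1ℤ) * (s * r + (M - 1ℤ) * (c - b * s)) - r * (- (s * (M + 1ℤ)) - y * (c - b * s))
                     + (c - b * s) * (M * M)
                 ≡ c + (c - b * s) * (y * r)
        identity = solve (s ∷ c ∷ vars)

      index-edge₂ : ∀ {c} → 0ℤ < c → boundary-index (edge₂-point c) ≡ c
      index-edge₂ {c} 0<c with v₃ · edge₂-point c ≟ s | v₂ · edge₂-point c ≟ s
      ... | yes on₃ | _       = ⊥-elim (≢-from-slack (edge₂-slack₃ c) (*-pos 0<x 0<c) on₃)
      ... | no _    | yes _   = ℤP.neg-involutive c
      ... | no _    | no off₂ = ⊥-elim (off₂ (edge₂-on₂ c))

      index-edge₃ : ∀ c → boundary-index (edge₃-point c) ≡ c
      index-edge₃ c with v₃ · edge₃-point c ≟ s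
      ... | yes _ = identity
        where
        identity : b * s - (b * s - c) ≡ c
        identity = solve (s ∷ c ∷ vars)
      ... | no off₃ = ⊥-elim (off₃ (edge₃-on₃ c))

      boundary-point-spec : ∀ {c} → 0ℤ < c → c ≤ b * s →
                            Boundary s (boundary-point c) × boundary-index (boundary-point c) ≡ c
      boundary-point-spec {c} 0<c c≤bs with z * c ≤? s * M | y * (b * s - c) ≤? s * M
      ... | yes zc≤sM | _         = edge₂-point∈Boundary 0<c zc≤sM , index-edge₂ 0<c
      ... | no _      | yes yv≤sM = edge₃-point∈Boundary c≤bs yv≤sM , index-edge₃ c
      ... | no zc≰sM  | no yv≰sM  =
        edge₁-point∈Boundary (ℤP.≰⇒> zc≰sM) (ℤP.≰⇒> yv≰sM) , index-edge₁ (ℤP.≰⇒> zc≰sM) (ℤP.≰⇒> yv≰sM)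

      on-edge₁ : ∀ {p q} → v₁ · (p , q) ≡ s → (p , q) ≡ edge₁-point (b * s - (M + 1ℤ) * p - r * q)
      on-edge₁ {p} {q} on₁ = cong₂ _,_
        (linear-combination (cong₂ _+_ (cong (r *_) (sym on₁)) (cong (p *_) yr≡M²)) identity₁)
        (linear-combination (cong₂ _+_ (cong ((M + 1ℤ) *_) on₁) (cong (q *_) yr≡M²)) identity₂)
        where
        identity₁ : p + (r * s + p * (y * r))
                  ≡ s * r + (M - 1ℤ) * (b * s - (M + 1ℤ) * p - r * q - b * s)
                      + (r * (y * p + (M - 1ℤ) * q) + p * (M * M))
        identity₁ = solve (s ∷ p ∷ q ∷ vars)
        identity₂ : q + ((M + 1ℤ) * (y * p + (M - 1ℤ) * q) + q * (y * r))
                  ≡ - (s * (M + 1ℤ)) - y * (b * s - (M + 1ℤ) * p - r * q - b * s)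
                      + ((M + 1ℤ) * s + q * (M * M))
        identity₂ = solve (s ∷ p ∷ q ∷ vars)

      on-edge₂ : ∀ {p q} → v₂ · (p , q) ≡ s → (p , q) ≡ edge₂-point (- p)
      on-edge₂ {p} {q} on₂ = cong₂ _,_ (sym (ℤP.neg-involutive p)) (linear-combination on₂ identity)
        where
        identity : q + (- x * p + -1ℤ * q) ≡ x * - p - s + s
        identity = solve (s ∷ p ∷ q ∷ vars)

      on-edge₃ : ∀ {p q} → v₃ · (p , q) ≡ s → (p , q) ≡ edge₃-point (b * s - p)
      on-edge₃ {p} {q} on₃ = cong₂ _,_ (solve (s ∷ p ∷ vars)) (linear-combination on₃ identity)
        where
        identity : q + (0ℤ * p + -1ℤ * q) ≡ - s + s
        identity = solve (s ∷ p ∷ q ∷ [])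

      edge₁-param : ∀ {a c} → a ≡ edge₁-point c → Dilate s a → v₂ · a ≢ s → v₃ · a ≢ s →
                    0ℤ < c × c ≤ b * s × boundary-point c ≡ a
      edge₁-param {c = c} refl (_ , on₂ , on₃) off₂ off₃ =
        param-pos (ℤP.<⇒≱ sM<zc) , param≤bs (ℤP.<⇒≱ sM<yv) , boundary-point-edge₁ sM<zc sM<yv
        where
        sM<zc : s * M < z * c
        sM<zc = <-from-slack refl (slack-pos (edge₁-slack₂ c) (ℤP.≤∧≢⇒< on₂ off₂))
        sM<yv : s * M < y * (b * s - c)
        sM<yv = <-from-slack refl (slack-pos (edge₁-slack₃ c) (ℤP.≤∧≢⇒< on₃ off₃))

      edge₂-param : ∀ {a c} → a ≡ edge₂-point c → Dilate s a → v₃ · a ≢ s →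
                    0ℤ < c × c ≤ b * s × boundary-point c ≡ a
      edge₂-param {c = c} refl (on₁ , _ , on₃) off₃ =
        *-pos⁻¹ 0<x (slack-pos (edge₂-slack₃ c) (ℤP.≤∧≢⇒< on₃ off₃)) ,
        param≤bs (edge-ranges-disjoint 0<s zc≤sM) ,
        boundary-point-edge₂ zc≤sM
        where
        zc≤sM : z * c ≤ s * M
        zc≤sM = ≤-from-slack refl (slack-nonNeg (edge₂-slack₁ c) on₁)

      edge₃-param : ∀ {a c} → a ≡ edge₃-point c → Dilate s a → 0ℤ < c × c ≤ b * s × boundary-point c ≡ a
      edge₃-param {c = c} refl (on₁ , on₂ , _) =
        param-pos (λ zc≤sM → edge-ranges-disjoint 0<s zc≤sM yv≤sM) ,
        ≤-from-slack refl (*-nonNeg⁻¹ 0<x (slack-nonNeg (edge₃-slack₂ c) on₂)) ,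
        boundary-point-edge₃ yv≤sM
        where
        yv≤sM : y * (b * s - c) ≤ s * M
        yv≤sM = ≤-from-slack refl (slack-nonNeg (edge₃-slack₁ c) on₁)

      boundary-point-onto : ∀ {a} → Boundary s a → ∃ λ c → 0ℤ < c × c ≤ b * s × boundary-point c ≡ a
      boundary-point-onto {p , q} (a∈sT , on) with v₃ · (p , q) ≟ s | v₂ · (p , q) ≟ s
      ... | yes on₃ | _       = b * s - p , edge₃-param (on-edge₃ on₃) a∈sT
      ... | no off₃ | yes on₂ = - p , edge₂-param (on-edge₂ on₂) a∈sT off₃
      ... | no off₃ | no off₂ = b * s - (M + 1ℤ) * p - r * q , edge₁-param (on-edge₁ on₁) a∈sT off₂ off₃
        where
        on₁ : v₁ · (p , q) ≡ s
        on₁ = [ id , [ ⊥-elim ∘ off₂ , ⊥-elim ∘ off₃ ]′ ]′ on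

      boundary-count : ∀ n → + n ≡ b * s → HasCard (Boundary s) n
      boundary-count n n≡bs =
        HasCard-interval n boundary-point boundary-index (proj₁ ∘₂ spec) (proj₂ ∘₂ spec) onto
        where
        spec : ∀ {c} → 0ℤ < c → c ≤ + n → Boundary s (boundary-point c) × boundary-index (boundary-point c) ≡ c
        spec {c} 0<c c≤n = boundary-point-spec 0<c (subst (c ≤_) n≡bs c≤n)

        onto : ∀ {a} → Boundary s a → ∃ λ c → 0ℤ < c × c ≤ + n × boundary-point c ≡ a
        onto a∈∂sT with boundary-point-onto a∈∂sT
        ... | c , 0<c , c≤bs , c↦a = c , 0<c , subst (c ≤_) (sym n≡bs) c≤bs , c↦a

    open Layer public using (boundary-count)

    top-of : ∀ {t v} → v ≤ + suc t → ¬ (v ≤ + t) → v ≡ + suc t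
    top-of v≤t+1 v≰t = ℤP.≤-antisym v≤t+1 (ℤP.i<j⇒suc[i]≤j (ℤP.≰⇒> v≰t))

    dilate-suc : ∀ t → Dilate (+ suc t) ≐ Boundary (+ suc t) ∪ Dilate (+ t)
    dilate-suc t = split , [ proj₁ , widen ]′
      where
      widen : Dilate (+ t) ⊆ Dilate (+ suc t)
      widen (α≤t , β≤t , γ≤t) = ℤP.i≤j⇒i≤1+j α≤t , ℤP.i≤j⇒i≤1+j β≤t , ℤP.i≤j⇒i≤1+j γ≤t

      split : Dilate (+ suc t) ⊆ Boundary (+ suc t) ∪ Dilate (+ t)
      split {a} a∈T@(α≤t+1 , β≤t+1 , γ≤t+1) with v₁ · a ≤? + t | v₂ · a ≤? + t | v₃ · a ≤? + t
      ... | no α≰t  | _       | _       = inj₁ (a∈T , inj₁ (top-of α≤t+1 α≰t))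
      ... | yes _   | no β≰t  | _       = inj₁ (a∈T , inj₂ (inj₁ (top-of β≤t+1 β≰t)))
      ... | yes _   | yes _   | no γ≰t  = inj₁ (a∈T , inj₂ (inj₂ (top-of γ≤t+1 γ≰t)))
      ... | yes α≤t | yes β≤t | yes γ≤t = inj₂ (α≤t , β≤t , γ≤t)

    boundary-outside : ∀ t → Empty (Boundary (+ suc t) ∩ Dilate (+ t))
    boundary-outside t a ((_ , on) , α≤t , β≤t , γ≤t) = [ above α≤t , [ above β≤t , above γ≤t ]′ ]′ on
      where
      above : ∀ {v} → v ≤ + t → v ≢ + suc t
      above v≤t refl = ℤP.<-irrefl refl (ℤP.≤-<-trans v≤t (+<+ (ℕP.n<1+n t)))

    dilate-count : ∀ b₀ → b ≡ + b₀ → ∀ t → HasCard (Dilate (+ t)) (1 ℕ.+ b₀ ℕ.* triangular t)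
    dilate-count b₀ b≡b₀ zero = subst (HasCard (Dilate 0ℤ)) (cong suc (sym (ℕP.*-zeroʳ b₀)))
      (HasCard-cong origin≐Dilate₀ (HasCard-singleton (0ℤ , 0ℤ)))
    dilate-count b₀ b≡b₀ (suc t) = subst (HasCard (Dilate (+ suc t))) (count-step b₀ (suc t) (triangular t))
      (HasCard-cong (swap (dilate-suc t))
        (HasCard-∪ (boundary-outside t)
                   (boundary-count (+ suc t) (+<+ (ℕ.s≤s ℕ.z≤n)) (b₀ ℕ.* suc t) b₀t≡bt)
                   (dilate-count b₀ b≡b₀ t)))
      where
      b₀t≡bt : + (b₀ ℕ.* suc t) ≡ b * + suc t
      b₀t≡bt = trans (ℤP.pos-* b₀ (suc t)) (cong (_* + suc t) (sym b≡b₀))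
      count-step : ∀ b t n → b ℕ.* t ℕ.+ (1 ℕ.+ b ℕ.* n) ≡ 1 ℕ.+ b ℕ.* (t ℕ.+ n)
      count-step = ℕ-Ring.solve-∀

  record Admissible (b x y z : ℤ) : Set where
    field
      0<x : 0ℤ < x
      0<y : 0ℤ < y
      0<z : 0ℤ < z
      markov : (x + y + z) * (x + y + z) ≡ b * x * y * z
      x∣y+z : x ∣ y + z
      x∣by : x ∣ b * y
      x∣bz : x ∣ b * z

  vieta-jump : ℤ → ℤ → ℤ → ℤ → ℤ
  vieta-jump b x y z = b * x * z - + 2 * (x + z) - y

  module _ {b x y z} (adm : Admissible b x y z) where

    open Admissible adm

    vieta-product : y * vieta-jump b x y z ≡ (x + z) * (x + z)
    vieta-product = linear-combination markov identity
      where
      identity : y * (b * x * z - + 2 * (x + z) - y) + (x + y + z) * (x + y + z)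
               ≡ (x + z) * (x + z) + b * x * y * z
      identity = solve (b ∷ x ∷ y ∷ z ∷ [])

    admissible-jump : Admissible b x z (vieta-jump b x y z)
    admissible-jump = record
      { 0<x    = 0<x
      ; 0<y    = 0<z
      ; 0<z    = *-pos⁻¹ 0<y (subst (0ℤ <_) (sym vieta-product) (*-pos 0<x+z 0<x+z))
      ; markov = linear-combination (sym markov) markov-identity
      ; x∣y+z  = subst (x ∣_) sum-identity (∣m∣n⇒∣m-n (∣n⇒∣m*n (b * z - + 2) ∣-refl) x∣y+z)
      ; x∣by   = x∣bz
      ; x∣bz   = subst (x ∣_) b-identity
                   (∣m∣n⇒∣m-n (∣m∣n⇒∣m-n (∣n⇒∣m*n (b * b * z - + 2 * b) ∣-refl) (∣n⇒∣m*n (+ 2) x∣bz)) x∣by)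
      }
      where
      0<x+z : 0ℤ < x + z
      0<x+z = ℤP.+-mono-< 0<x 0<z
      markov-identity : (x + z + (b * x * z - + 2 * (x + z) - y)) * (x + z + (b * x * z - + 2 * (x + z) - y))
                          + b * x * y * z
                      ≡ b * x * z * (b * x * z - + 2 * (x + z) - y) + (x + y + z) * (x + y + z)
      markov-identity = solve (b ∷ x ∷ y ∷ z ∷ [])
      sum-identity : (b * z - + 2) * x - (y + z) ≡ z + (b * x * z - + 2 * (x + z) - y)
      sum-identity = solve (b ∷ x ∷ y ∷ z ∷ [])
      b-identity : (b * b * z - + 2 * b) * x - + 2 * (b * z) - b * y ≡ b * (b * x * z - + 2 * (x + z) - y)
      b-identity = solve (b ∷ x ∷ y ∷ z ∷ [])

  admissible-seq : ∀ {b x y₀ z₀} → Admissible (+ b) (+ x) (+ y₀) (+ z₀) →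
                   ∀ j → Admissible (+ b) (+ x) (seqY b x y₀ z₀ j) (seqZ b x y₀ z₀ j)
  admissible-seq adm zero    = adm
  admissible-seq adm (suc j) = admissible-jump (admissible-seq adm j)

  root-admissible : ∀ {b x y z} .{{_ : NonZero x}} .{{_ : NonZero y}} .{{_ : NonZero z}} →
                    x ℕ.≤ y → y ℕ.≤ z → z ℕ.≤ x ℕ.+ y → (x ℕ.+ y ℕ.+ z) ℕ.^ 2 ≡ b ℕ.* x ℕ.* y ℕ.* z →
                    Admissible (+ b) (+ x) (+ y) (+ z)
  root-admissible {b} {x} {y} {z} x≤y y≤z z≤x+y markov = record
    { 0<x    = +<+ (ℕ.>-nonZero⁻¹ x)
    ; 0<y    = +<+ (ℕ.>-nonZero⁻¹ y)
    ; 0<z    = +<+ (ℕ.>-nonZero⁻¹ z)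
    ; markov = markovℤ
    ; x∣y+z  = subst (+ x ∣_) (ℤP.pos-+ y z) (∣ᵤ⇒∣ (proj₁ divisible))
    ; x∣by   = subst (+ x ∣_) (ℤP.pos-* b y) (∣ᵤ⇒∣ (proj₁ (proj₂ divisible)))
    ; x∣bz   = subst (+ x ∣_) (ℤP.pos-* b z) (∣ᵤ⇒∣ (proj₂ (proj₂ divisible)))
    }
    where
    N : ℕ
    N = x ℕ.+ y ℕ.+ z

    N*N≡bxyz : N ℕ.* N ≡ b ℕ.* x ℕ.* y ℕ.* z
    N*N≡bxyz = trans (cong (N ℕ.*_) (sym (ℕP.*-identityʳ N))) markov

    divisible : x ℕᵈ.∣ y ℕ.+ z × x ℕᵈ.∣ b ℕ.* y × x ℕᵈ.∣ b ℕ.* z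
    divisible = root-divisible {b} (ℕ.>-nonZero⁻¹ x) x≤y y≤z z≤x+y N*N≡bxyz

    markovℤ : (+ x + + y + + z) * (+ x + + y + + z) ≡ + b * + x * + y * + z
    markovℤ = begin
      (+ x + + y + + z) * (+ x + + y + + z)   ≡⟨ cong₂ _*_ +N≡ +N≡ ⟨
      + N * + N                               ≡⟨ ℤP.pos-* N N ⟨
      + (N ℕ.* N)                             ≡⟨ cong +_ N*N≡bxyz ⟩
      + (b ℕ.* x ℕ.* y ℕ.* z)                 ≡⟨ ℤP.pos-* (b ℕ.* x ℕ.* y) z ⟩
      + (b ℕ.* x ℕ.* y) * + z                 ≡⟨ cong (_* + z) (ℤP.pos-* (b ℕ.* x) y) ⟩
      + (b ℕ.* x) * + y * + z                 ≡⟨ cong (λ u → u * + y * + z) (ℤP.pos-* b x) ⟩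
      + b * + x * + y * + z                   ∎
      where
      open ≡-Reasoning
      +N≡ : + N ≡ + x + + y + + z
      +N≡ = trans (ℤP.pos-+ (x ℕ.+ y) z) (cong (_+ + z) (ℤP.pos-+ x y))

  module AdmissibleTriangle {b x : ℕ} .{{_ : NonZero x}} {y z w r : ℤ} (adm : Admissible (+ b) (+ x) y z)
    (y+z≡wx : y + z ≡ w * + x) (bz≡rx : + b * z ≡ r * + x) where

    open Admissible adm

    M : ℤ
    M = 1ℤ + w

    x+y+z≡Mx : + x + y + z ≡ M * + x
    x+y+z≡Mx = trans (ℤP.+-assoc (+ x) y z) (trans (cong (_+_ (+ x)) y+z≡wx) (sym (ℤP.suc-* w (+ x))))

    open Triangle (+ b) (+ x) y z M r 0<x 0<y 0<z x+y+z≡Mx markov bz≡rx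

    u₁≡v₁ : u₁ x y z ≡ emb v₁
    u₁≡v₁ = cong (ℤ→ℚ y ,_) (/-≡-ℤ→ℚ (y + z) x (M - 1ℤ) (trans y+z≡wx (cong (_* + x) w≡M-1)))
      where
      w≡M-1 : w ≡ 1ℤ + w - 1ℤ
      w≡M-1 = solve (w ∷ [])

    u₂≡v₂ : u₂ x ≡ emb v₂
    u₂≡v₂ = cong (_, ℚ.- 1ℚ) (sym (ℤ→ℚ-neg (+ x)))

    ⟪u₁,a⟫ : ∀ a → ⟪ u₁ x y z , emb a ⟫ ≡ ℤ→ℚ (v₁ · a)
    ⟪u₁,a⟫ a = trans (cong (λ u → ⟪ u , emb a ⟫) u₁≡v₁) (⟪emb,emb⟫ v₁ a)

    ⟪u₂,a⟫ : ∀ a → ⟪ u₂ x , emb a ⟫ ≡ ℤ→ℚ (v₂ · a)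
    ⟪u₂,a⟫ a = trans (cong (λ u → ⟪ u , emb a ⟫) u₂≡v₂) (⟪emb,emb⟫ v₂ a)

    ⟪u₃,a⟫ : ∀ a → ⟪ u₃ , emb a ⟫ ≡ ℤ→ℚ (v₃ · a)
    ⟪u₃,a⟫ = ⟪emb,emb⟫ v₃

    ≤-transfer : ∀ {q m n} → q ≡ ℤ→ℚ m → q ℚ.≤ ℤ→ℚ n → m ≤ n
    ≤-transfer refl = ℤ→ℚ-cancel-≤

    ≤-transfer⁻ : ∀ {q m n} → q ≡ ℤ→ℚ m → m ≤ n → q ℚ.≤ ℤ→ℚ n
    ≤-transfer⁻ refl = ℤ→ℚ-mono-≤

    <1-transfer : ∀ {q m} → q ≡ ℤ→ℚ m → q ℚ.< 1ℚ → m ≤ 0ℤ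
    <1-transfer {m = m} refl q<1 = ℤP.i<j⇒i≤pred[j] (ℤ→ℚ-cancel-< {m} {1ℤ} q<1)

    <1-transfer⁻ : ∀ {q m} → q ≡ ℤ→ℚ m → m ≤ 0ℤ → q ℚ.< 1ℚ
    <1-transfer⁻ {m = m} refl m≤0 = ℤ→ℚ-mono-< {m} {1ℤ} (ℤP.≤-<-trans m≤0 (+<+ (ℕ.s≤s ℕ.z≤n)))

    ≡1-transfer : ∀ {q m} → q ≡ ℤ→ℚ m → q ≡ 1ℚ → m ≡ 1ℤ
    ≡1-transfer refl = ℤ→ℚ-injective

    ≡1-transfer⁻ : ∀ {q m} → q ≡ ℤ→ℚ m → m ≡ 1ℤ → q ≡ 1ℚ
    ≡1-transfer⁻ refl refl = refl

    dilate≐ : ∀ t → (λ a → InDilate x y z t (emb a)) ≐ Dilate (+ t)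
    dilate≐ t =
      (λ {a} (h₁ , h₂ , h₃) →
         ≤-transfer (⟪u₁,a⟫ a) h₁ , ≤-transfer (⟪u₂,a⟫ a) h₂ , ≤-transfer (⟪u₃,a⟫ a) h₃) ,
      (λ {a} (h₁ , h₂ , h₃) →
         ≤-transfer⁻ (⟪u₁,a⟫ a) h₁ , ≤-transfer⁻ (⟪u₂,a⟫ a) h₂ , ≤-transfer⁻ (⟪u₃,a⟫ a) h₃)

    interior≐ : (λ a → InInterior x y z (emb a)) ≐ Dilate 0ℤ
    interior≐ =
      (λ {a} (h₁ , h₂ , h₃) →
         <1-transfer (⟪u₁,a⟫ a) h₁ , <1-transfer (⟪u₂,a⟫ a) h₂ , <1-transfer (⟪u₃,a⟫ a) h₃) ,
      (λ {a} (h₁ , h₂ , h₃) →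
         <1-transfer⁻ (⟪u₁,a⟫ a) h₁ , <1-transfer⁻ (⟪u₂,a⟫ a) h₂ , <1-transfer⁻ (⟪u₃,a⟫ a) h₃)

    boundary≐ : (λ a → OnBoundary x y z (emb a)) ≐ Boundary 1ℤ
    boundary≐ =
      (λ {a} (a∈T , on) → proj₁ (dilate≐ 1) a∈T ,
         Sum.map (≡1-transfer (⟪u₁,a⟫ a)) (Sum.map (≡1-transfer (⟪u₂,a⟫ a)) (≡1-transfer (⟪u₃,a⟫ a))) on) ,
      (λ {a} (a∈T , on) → proj₂ (dilate≐ 1) a∈T ,
         Sum.map (≡1-transfer⁻ (⟪u₁,a⟫ a)) (Sum.map (≡1-transfer⁻ (⟪u₂,a⟫ a)) (≡1-transfer⁻ (⟪u₃,a⟫ a))) on)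

    properties : Pseudointegral x y z ×
                 HasCard (λ a → InInterior x y z (emb a)) 1 ×
                 HasCard (λ a → OnBoundary x y z (emb a)) b
    properties =
      (ehrhart b , λ t _ → 1 ℕ.+ b ℕ.* triangular t ,
                           HasCard-cong (swap (dilate≐ t)) (dilate-count b refl t) ,
                           lattice-count-polynomial b t) ,
      HasCard-cong (swap interior≐) (HasCard-cong origin≐Dilate₀ (HasCard-singleton (0ℤ , 0ℤ))) ,
      HasCard-cong (swap boundary≐) (boundary-count 1ℤ (+<+ (ℕ.s≤s ℕ.z≤n)) b (sym (ℤP.*-identityʳ (+ b))))

  admissible-properties : ∀ {b x} .{{_ : NonZero x}} {y z} → Admissible (+ b) (+ x) y z →
                          Pseudointegral x y z ×
                          HasCard (λ a → InInterior x y z (emb a)) 1 ×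
                          HasCard (λ a → OnBoundary x y z (emb a)) b
  admissible-properties adm@record { x∣y+z = divides w y+z≡wx ; x∣bz = divides r bz≡rx } =
    AdmissibleTriangle.properties {w = w} {r = r} adm y+z≡wx bz≡rx

open LatticeTriangles using (admissible-properties; admissible-seq; root-admissible)

open import Data.Nat using (ℕ; _+_; _*_; _^_; _≤_; NonZero)
open import Data.Product using (_×_)
open import Relation.Binary.PropositionalEquality using (_≡_; _≢_)

theorem6p4 : (b : ℕ) → 1 ≤ b → b ≤ 9 → b ≢ 7 →
    (x y₀ z₀ : ℕ) .{{_ : NonZero x}} → .{{_ : NonZero y₀}} → .{{_ : NonZero z₀}} →
    (x + y₀ + z₀) ^ 2 ≡ b * x * y₀ * z₀ →
    x ≤ y₀ → y₀ ≤ z₀ → z₀ ≤ x + y₀ →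
    (j : ℕ) →
      Pseudointegral x (seqY b x y₀ z₀ j) (seqZ b x y₀ z₀ j) ×
      HasCard (λ a → InInterior x (seqY b x y₀ z₀ j) (seqZ b x y₀ z₀ j) (emb a)) 1 ×
      HasCard (λ a → OnBoundary x (seqY b x y₀ z₀ j) (seqZ b x y₀ z₀ j) (emb a)) b
theorem6p4 b _ _ _ x y₀ z₀ markov x≤y₀ y₀≤z₀ z₀≤x+y₀ j =
  admissible-properties (admissible-seq (root-admissible x≤y₀ y₀≤z₀ z₀≤x+y₀ markov) j)
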